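{- For every MAV structure $P$: if $P \longrightarrow^* \mathbf{1}$ in (full) MAV, then there is a normal derivation $P \longrightarrow^* \mathbf{1}$.
   Context: Fix a set of atoms $a$. MAV structures are generated by $P,Q,R,S ::= a \mid a^\perp \mid \mathbf{1} \mid P;Q \mid P\otimes Q \mid P⅋Q \mid P\& Q \mid P\oplus Q$. Duality $(-)^\perp$ is defined by $(a)^\perp=a^\perp$, $(a^\perp)^\perp=a$, $\mathbf 1^\perp=\mathbf 1$, $(P\otimes Q)^\perp=P^\perp⅋Q^\perp$, $(P⅋Q)^\perp=P^\perp\otimes Q^\perp$, $(P;Q)^\perp=P^\perp;Q^\perp$, $(P\&Q)^\perp=P^\perp\oplus Q^\perp$, $(P\oplus Q)^\perp=P^\perp\&Q^\perp$. Structures are identified modulo the least congruence $\equiv$ making $(;,\mathbf 1)$ a monoid and $(\otimes,\mathbf 1)$, $(⅋,\mathbf 1)$ commutative monoids. A context $C[-]$ is a structure with one hole, and $C[P]$ fills the hole with $P$. The one-step inference relation $P\longrightarrow Q$ (read: "$P$ can be inferred from $Q$") is the least relation containing the following axioms and closed under contexts (if $P\longrightarrow Q$ then $C[P]\longrightarrow C[Q]$): Interact: $P⅋P^\perp\longrightarrow\mathbf 1$; Switch: $(P\otimes Q)⅋R\longrightarrow P\otimes(Q⅋R)$; Tidy: $\mathbf 1\&\mathbf 1\longrightarrow\mathbf 1$; Sequence: $(P;Q)⅋(R;S)\longrightarrow(P⅋R);(Q⅋S)$; Left: $P\oplus Q\longrightarrow P$; Right: $P\oplus Q\longrightarrow Q$;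 External: $(P\&Q)⅋R\longrightarrow(P⅋R)\&(Q⅋R)$; Medial: $(P;Q)\&(R;S)\longrightarrow(P\&R);(Q\&S)$; CoInteract: $\mathbf 1\longrightarrow P\otimes P^\perp$; CoTidy: $\mathbf 1\longrightarrow\mathbf 1\oplus\mathbf 1$; CoSequence: $(P\otimes R);(Q\otimes S)\longrightarrow(P;Q)\otimes(R;S)$; CoLeft: $P\longrightarrow P\&Q$; CoRight: $Q\longrightarrow P\&Q$; CoExternal: $(P\otimes R)\oplus(Q\otimes R)\longrightarrow(P\oplus Q)\otimes R$; CoMedial: $(P\oplus R);(Q\oplus S)\longrightarrow(P;Q)\oplus(R;S)$. $\longrightarrow^*$ is the reflexive–transitive closure (derivation); a proof of $P$ is a derivation $P\longrightarrow^*\mathbf 1$. A derivation is normal if it uses none of the Co- rules and uses Interact only in the atomic form AtomInteract: $a^\perp⅋a\longrightarrow\mathbf 1$ (i.e. its steps are context-closed instances of Switch, Tidy, Sequence, Left, Right, External, Medial, AtomInteract, modulo $\equiv$). -}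

module Defs where

open import Data.Product using (Σ; _×_; _,_; ∃)

data Str (A : Set) : Set where
  atom  : A → Str A
  natom : A → Str A
  𝟙     : Str A
  _︔_   : Str A → Str A → Str A
  _⊗_   : Str A → Str A → Str A
  _⅋_   : Str A → Str A → Str A
  _&_   : Str A → Str A → Str A
  _⊕_   : Str A → Str A → Str A

infixr 6 _︔_ _⊗_ _⅋_ _&_ _⊕_

module _ {A : Set} where

  _⊥ : Str A → Str A
  atom a ⊥  = natom a
  natom a ⊥ = atom a
  𝟙 ⊥       = 𝟙
  (P ︔ Q) ⊥ = (P ⊥) ︔ (Q ⊥)
  (P ⊗ Q) ⊥ = (P ⊥) ⅋ (Q ⊥)
  (P ⅋ Q) ⊥ = (P ⊥) ⊗ (Q ⊥)
  (P & Q) ⊥ = (P ⊥) ⊕ (Q ⊥)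
  (P ⊕ Q) ⊥ = (P ⊥) & (Q ⊥)

  infix 4 _≈_
  data _≈_ : Str A → Str A → Set where
    ≈-refl  : ∀ {P} → P ≈ P
    ≈-sym   : ∀ {P Q} → P ≈ Q → Q ≈ P
    ≈-trans : ∀ {P Q R} → P ≈ Q → Q ≈ R → P ≈ R
    ︔-cong : ∀ {P P' Q Q'} → P ≈ P' → Q ≈ Q' → (P ︔ Q) ≈ (P' ︔ Q')
    ⊗-cong : ∀ {P P' Q Q'} → P ≈ P' → Q ≈ Q' → (P ⊗ Q) ≈ (P' ⊗ Q')
    ⅋-cong : ∀ {P P' Q Q'} → P ≈ P' → Q ≈ Q' → (P ⅋ Q) ≈ (P' ⅋ Q')
    &-cong : ∀ {P P' Q Q'} → P ≈ P' → Q ≈ Q' → (P & Q) ≈ (P' & Q')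
    ⊕-cong : ∀ {P P' Q Q'} → P ≈ P' → Q ≈ Q' → (P ⊕ Q) ≈ (P' ⊕ Q')
    ︔-assoc : ∀ {P Q R} → ((P ︔ Q) ︔ R) ≈ (P ︔ (Q ︔ R))
    ︔-unitˡ : ∀ {P} → (𝟙 ︔ P) ≈ P
    ︔-unitʳ : ∀ {P} → (P ︔ 𝟙) ≈ P
    ⊗-assoc : ∀ {P Q R} → ((P ⊗ Q) ⊗ R) ≈ (P ⊗ (Q ⊗ R))
    ⊗-comm  : ∀ {P Q} → (P ⊗ Q) ≈ (Q ⊗ P)
    ⊗-unit  : ∀ {P} → (𝟙 ⊗ P) ≈ P
    ⅋-assoc : ∀ {P Q R} → ((P ⅋ Q) ⅋ R) ≈ (P ⅋ (Q ⅋ R))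
    ⅋-comm  : ∀ {P Q} → (P ⅋ Q) ≈ (Q ⅋ P)
    ⅋-unit  : ∀ {P} → (𝟙 ⅋ P) ≈ P

  data Ctx : Set where
    ∙    : Ctx
    _︔ˡ_ : Ctx → Str A → Ctx
    _︔ʳ_ : Str A → Ctx → Ctx
    _⊗ˡ_ : Ctx → Str A → Ctx
    _⊗ʳ_ : Str A → Ctx → Ctx
    _⅋ˡ_ : Ctx → Str A → Ctx
    _⅋ʳ_ : Str A → Ctx → Ctx
    _&ˡ_ : Ctx → Str A → Ctx
    _&ʳ_ : Str A → Ctx → Ctx
    _⊕ˡ_ : Ctx → Str A → Ctx
    _⊕ʳ_ : Str A → Ctx → Ctx

  _[_] : Ctx → Str A → Str A
  ∙ [ P ]        = P
  (C ︔ˡ Q) [ P ] = (C [ P ]) ︔ Q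
  (Q ︔ʳ C) [ P ] = Q ︔ (C [ P ])
  (C ⊗ˡ Q) [ P ] = (C [ P ]) ⊗ Q
  (Q ⊗ʳ C) [ P ] = Q ⊗ (C [ P ])
  (C ⅋ˡ Q) [ P ] = (C [ P ]) ⅋ Q
  (Q ⅋ʳ C) [ P ] = Q ⅋ (C [ P ])
  (C &ˡ Q) [ P ] = (C [ P ]) & Q
  (Q &ʳ C) [ P ] = Q & (C [ P ])
  (C ⊕ˡ Q) [ P ] = (C [ P ]) ⊕ Q
  (Q ⊕ʳ C) [ P ] = Q ⊕ (C [ P ])

  -- Axioms of (full) MAV:  Ax P Q  means  P ⟶ Q  (P can be inferred from Q)
  data MAVAx : Str A → Str A → Set where
    interact    : ∀ {P} → MAVAx (P ⅋ (P ⊥)) 𝟙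
    switch      : ∀ {P Q R} → MAVAx ((P ⊗ Q) ⅋ R) (P ⊗ (Q ⅋ R))
    tidy        : MAVAx (𝟙 & 𝟙) 𝟙
    sequence    : ∀ {P Q R S} → MAVAx ((P ︔ Q) ⅋ (R ︔ S)) ((P ⅋ R) ︔ (Q ⅋ S))
    left        : ∀ {P Q} → MAVAx (P ⊕ Q) P
    right       : ∀ {P Q} → MAVAx (P ⊕ Q) Q
    external    : ∀ {P Q R} → MAVAx ((P & Q) ⅋ R) ((P ⅋ R) & (Q ⅋ R))
    medial      : ∀ {P Q R S} → MAVAx ((P ︔ Q) & (R ︔ S)) ((P & R) ︔ (Q & S))
    cointeract  : ∀ {P} → MAVAx 𝟙 (P ⊗ (P ⊥))
    cotidy      : MAVAx 𝟙 (𝟙 ⊕ 𝟙)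
    cosequence  : ∀ {P Q R S} → MAVAx ((P ⊗ R) ︔ (Q ⊗ S)) ((P ︔ Q) ⊗ (R ︔ S))
    coleft      : ∀ {P Q} → MAVAx P (P & Q)
    coright     : ∀ {P Q} → MAVAx Q (P & Q)
    coexternal  : ∀ {P Q R} → MAVAx ((P ⊗ R) ⊕ (Q ⊗ R)) ((P ⊕ Q) ⊗ R)
    comedial    : ∀ {P Q R S} → MAVAx ((P ⊕ R) ︔ (Q ⊕ S)) ((P ︔ Q) ⊕ (R ︔ S))

  data NormalAx : Str A → Str A → Set where
    atomInteract : ∀ {a} → NormalAx (natom a ⅋ atom a) 𝟙
    switch       : ∀ {P Q R} → NormalAx ((P ⊗ Q) ⅋ R) (P ⊗ (Q ⅋ R))
    tidy         : NormalAx (𝟙 & 𝟙) 𝟙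
    sequence     : ∀ {P Q R S} → NormalAx ((P ︔ Q) ⅋ (R ︔ S)) ((P ⅋ R) ︔ (Q ⅋ S))
    left         : ∀ {P Q} → NormalAx (P ⊕ Q) P
    right        : ∀ {P Q} → NormalAx (P ⊕ Q) Q
    external     : ∀ {P Q R} → NormalAx ((P & Q) ⅋ R) ((P ⅋ R) & (Q ⅋ R))
    medial       : ∀ {P Q R S} → NormalAx ((P ︔ Q) & (R ︔ S)) ((P & R) ︔ (Q & S))

  -- One step, closed under contexts, modulo ≈ (structures are ≈-classes)
  record Step (Ax : Str A → Str A → Set) (P Q : Str A) : Set where
    constructor step
    field
      ctx   : Ctx
      lhs   : Str A
      rhs   : Str A
      src≈  : P ≈ ctx [ lhs ]
      axiom : Ax lhs rhs
      tgt≈  : ctx [ rhs ] ≈ Q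

  data Derivation (Ax : Str A → Str A → Set) : Str A → Str A → Set where
    done : ∀ {P Q} → P ≈ Q → Derivation Ax P Q
    _∷_  : ∀ {P Q R} → Step Ax P Q → Derivation Ax Q R → Derivation Ax P R

  _⟶*_ : Str A → Str A → Set
  P ⟶* Q = Derivation MAVAx P Q

  _⟶ₙ*_ : Str A → Str A → Set
  P ⟶ₙ* Q = Derivation NormalAx P Q

{-# OPTIONS --safe #-}
-- Semantic cut elimination. Ideals (down-closed, &-closed sets) of structures, ordered by normal
-- derivability, carry ⅋ and ︔ as Day convolutions; the Chu construction over them, with the
-- normally provable structures as dualising object, yields a self-dual model ⟦_⟧ of MAV in which
-- every rule, the co-rules and general interaction included, is sound. Okada's lemma says that P
-- lies in the positive part of ⟦ P ⟧; so if P ⟶* 𝟙 then P lies in the positive part of ⟦ 𝟙 ⟧,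
-- which consists of the normally provable structures.

module Submission where

open import Level using (0ℓ)
open import Algebra.Bundles using (CommutativeSemigroup)
open import Data.Product using (∃₂; _×_; _,_; proj₁; proj₂)
open import Data.Sum as ⊎ using (inj₁; inj₂)
open import Relation.Binary.Bundles using (Preorder)
open import Relation.Binary.Structures using (IsEquivalence)
open import Relation.Binary.PropositionalEquality using (_≡_; refl; sym; cong; cong₂)
open import Relation.Unary using (Pred; _⊆_; _∩_; _∪_; _⊢_)
import Algebra.Properties.CommutativeSemigroup as CommutativeSemigroupProperties
import Relation.Binary.Reasoning.Preorder as PreorderReasoning

open import Defs

module _ {A : Set} where

  private variable
    P Q R P′ Q′ P₁ P₂ Q₁ Q₂ : Str A

  -- Normal derivability as a precongruence

  ≈-isEquivalence : IsEquivalence (_≈_ {A})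
  ≈-isEquivalence = record { refl = ≈-refl ; sym = ≈-sym ; trans = ≈-trans }

  open IsEquivalence ≈-isEquivalence using () renaming (reflexive to ≡⇒≈)

  ⅋-commutativeSemigroup : CommutativeSemigroup 0ℓ 0ℓ
  ⅋-commutativeSemigroup = record
    { Carrier = Str A
    ; _≈_ = _≈_
    ; _∙_ = _⅋_
    ; isCommutativeSemigroup = record
      { isSemigroup = record
        { isMagma = record { isEquivalence = ≈-isEquivalence ; ∙-cong = ⅋-cong }
        ; assoc = λ _ _ _ → ⅋-assoc }
      ; comm = λ _ _ → ⅋-comm } }

  open CommutativeSemigroupProperties ⅋-commutativeSemigroup
    using (xy∙z≈y∙xz; x∙yz≈y∙xz; x∙yz≈zx∙y; x∙yz≈yx∙z)

  ⟶ₙ*-refl : P ⟶ₙ* P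
  ⟶ₙ*-refl = done ≈-refl

  ≈-⟶ₙ*-trans : P ≈ Q → Q ⟶ₙ* R → P ⟶ₙ* R
  ≈-⟶ₙ*-trans P≈Q (done Q≈R) = done (≈-trans P≈Q Q≈R)
  ≈-⟶ₙ*-trans P≈Q (step C l r Q≈Cl ax Cr≈R ∷ d) = step C l r (≈-trans P≈Q Q≈Cl) ax Cr≈R ∷ d

  ⟶ₙ*-trans : P ⟶ₙ* Q → Q ⟶ₙ* R → P ⟶ₙ* R
  ⟶ₙ*-trans (done P≈Q) e = ≈-⟶ₙ*-trans P≈Q e
  ⟶ₙ*-trans (s ∷ d)    e = s ∷ ⟶ₙ*-trans d e

  ⟶ₙ*-preorder : Preorder 0ℓ 0ℓ 0ℓ
  ⟶ₙ*-preorder = record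
    { Carrier = Str A
    ; _≈_ = _≈_
    ; _≲_ = _⟶ₙ*_
    ; isPreorder = record { isEquivalence = ≈-isEquivalence ; reflexive = done ; trans = ⟶ₙ*-trans } }

  module ⟶ₙ*-Reasoning = PreorderReasoning ⟶ₙ*-preorder

  normal-axiom : NormalAx P Q → P ⟶ₙ* Q
  normal-axiom ax = step ∙ _ _ ≈-refl ax ≈-refl ∷ done ≈-refl

  _⊚_ : Ctx {A} → Ctx {A} → Ctx {A}
  ∙        ⊚ D = D
  (C ︔ˡ Q) ⊚ D = (C ⊚ D) ︔ˡ Q
  (Q ︔ʳ C) ⊚ D = Q ︔ʳ (C ⊚ D)
  (C ⊗ˡ Q) ⊚ D = (C ⊚ D) ⊗ˡ Q
  (Q ⊗ʳ C) ⊚ D = Q ⊗ʳ (C ⊚ D)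
  (C ⅋ˡ Q) ⊚ D = (C ⊚ D) ⅋ˡ Q
  (Q ⅋ʳ C) ⊚ D = Q ⅋ʳ (C ⊚ D)
  (C &ˡ Q) ⊚ D = (C ⊚ D) &ˡ Q
  (Q &ʳ C) ⊚ D = Q &ʳ (C ⊚ D)
  (C ⊕ˡ Q) ⊚ D = (C ⊚ D) ⊕ˡ Q
  (Q ⊕ʳ C) ⊚ D = Q ⊕ʳ (C ⊚ D)

  ⊚-[] : (C D : Ctx) (P : Str A) → (C ⊚ D) [ P ] ≡ C [ D [ P ] ]
  ⊚-[] ∙        D P = refl
  ⊚-[] (C ︔ˡ Q) D P = cong (_︔ Q) (⊚-[] C D P)
  ⊚-[] (Q ︔ʳ C) D P = cong (Q ︔_) (⊚-[] C D P)
  ⊚-[] (C ⊗ˡ Q) D P = cong (_⊗ Q) (⊚-[] C D P)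
  ⊚-[] (Q ⊗ʳ C) D P = cong (Q ⊗_) (⊚-[] C D P)
  ⊚-[] (C ⅋ˡ Q) D P = cong (_⅋ Q) (⊚-[] C D P)
  ⊚-[] (Q ⅋ʳ C) D P = cong (Q ⅋_) (⊚-[] C D P)
  ⊚-[] (C &ˡ Q) D P = cong (_& Q) (⊚-[] C D P)
  ⊚-[] (Q &ʳ C) D P = cong (Q &_) (⊚-[] C D P)
  ⊚-[] (C ⊕ˡ Q) D P = cong (_⊕ Q) (⊚-[] C D P)
  ⊚-[] (Q ⊕ʳ C) D P = cong (Q ⊕_) (⊚-[] C D P)

  []-cong : (C : Ctx) → P ≈ Q → C [ P ] ≈ C [ Q ]
  []-cong ∙        e = e
  []-cong (C ︔ˡ R) e = ︔-cong ([]-cong C e) ≈-refl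
  []-cong (R ︔ʳ C) e = ︔-cong ≈-refl ([]-cong C e)
  []-cong (C ⊗ˡ R) e = ⊗-cong ([]-cong C e) ≈-refl
  []-cong (R ⊗ʳ C) e = ⊗-cong ≈-refl ([]-cong C e)
  []-cong (C ⅋ˡ R) e = ⅋-cong ([]-cong C e) ≈-refl
  []-cong (R ⅋ʳ C) e = ⅋-cong ≈-refl ([]-cong C e)
  []-cong (C &ˡ R) e = &-cong ([]-cong C e) ≈-refl
  []-cong (R &ʳ C) e = &-cong ≈-refl ([]-cong C e)
  []-cong (C ⊕ˡ R) e = ⊕-cong ([]-cong C e) ≈-refl
  []-cong (R ⊕ʳ C) e = ⊕-cong ≈-refl ([]-cong C e)

  []-mono : (C : Ctx) → P ⟶ₙ* Q → (C [ P ]) ⟶ₙ* (C [ Q ])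
  []-mono C (done P≈Q) = done ([]-cong C P≈Q)
  []-mono C (step D l r P≈Dl ax Dr≈Q ∷ d) =
    step (C ⊚ D) l r
      (≈-trans ([]-cong C P≈Dl) (≡⇒≈ (sym (⊚-[] C D l))))
      ax
      (≈-trans (≡⇒≈ (⊚-[] C D r)) ([]-cong C Dr≈Q))
    ∷ []-mono C d

  ⅋-mono : P ⟶ₙ* P′ → Q ⟶ₙ* Q′ → (P ⅋ Q) ⟶ₙ* (P′ ⅋ Q′)
  ⅋-mono {P′ = P′} {Q = Q} P⟶P′ Q⟶Q′ =
    ⟶ₙ*-trans ([]-mono (∙ ⅋ˡ Q) P⟶P′) ([]-mono (P′ ⅋ʳ ∙) Q⟶Q′)

  ⊗-mono : P ⟶ₙ* P′ → Q ⟶ₙ* Q′ → (P ⊗ Q) ⟶ₙ* (P′ ⊗ Q′)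
  ⊗-mono {P′ = P′} {Q = Q} P⟶P′ Q⟶Q′ =
    ⟶ₙ*-trans ([]-mono (∙ ⊗ˡ Q) P⟶P′) ([]-mono (P′ ⊗ʳ ∙) Q⟶Q′)

  ︔-mono : P ⟶ₙ* P′ → Q ⟶ₙ* Q′ → (P ︔ Q) ⟶ₙ* (P′ ︔ Q′)
  ︔-mono {P′ = P′} {Q = Q} P⟶P′ Q⟶Q′ =
    ⟶ₙ*-trans ([]-mono (∙ ︔ˡ Q) P⟶P′) ([]-mono (P′ ︔ʳ ∙) Q⟶Q′)

  &-mono : P ⟶ₙ* P′ → Q ⟶ₙ* Q′ → (P & Q) ⟶ₙ* (P′ & Q′)
  &-mono {P′ = P′} {Q = Q} P⟶P′ Q⟶Q′ =
    ⟶ₙ*-trans ([]-mono (∙ &ˡ Q) P⟶P′) ([]-mono (P′ &ʳ ∙) Q⟶Q′)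

  ⅋-sequence : P ⟶ₙ* (P₁ ︔ P₂) → Q ⟶ₙ* (Q₁ ︔ Q₂) → (P ⅋ Q) ⟶ₙ* ((P₁ ⅋ Q₁) ︔ (P₂ ⅋ Q₂))
  ⅋-sequence P⟶ Q⟶ = ⟶ₙ*-trans (⅋-mono P⟶ Q⟶) (normal-axiom sequence)

  Provable : Pred (Str A) 0ℓ
  Provable P = P ⟶ₙ* 𝟙

  ⅋-provableˡ : Provable P → (P ⅋ Q) ⟶ₙ* Q
  ⅋-provableˡ ⊢P = ⟶ₙ*-trans (⅋-mono ⊢P ⟶ₙ*-refl) (done ⅋-unit)

  ⅋-provableʳ : Provable Q → (P ⅋ Q) ⟶ₙ* P
  ⅋-provableʳ ⊢Q = ≈-⟶ₙ*-trans ⅋-comm (⅋-provableˡ ⊢Q)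

  ︔-provableˡ : Provable P → (P ︔ Q) ⟶ₙ* Q
  ︔-provableˡ ⊢P = ⟶ₙ*-trans (︔-mono ⊢P ⟶ₙ*-refl) (done ︔-unitˡ)

  ︔-provableʳ : Provable Q → (P ︔ Q) ⟶ₙ* P
  ︔-provableʳ ⊢Q = ⟶ₙ*-trans (︔-mono ⟶ₙ*-refl ⊢Q) (done ︔-unitʳ)

  ⊗-discharge : Provable (Q ⅋ R) → ((P ⊗ Q) ⅋ R) ⟶ₙ* P
  ⊗-discharge {Q} {R} {P} ⊢Q⅋R = begin
    (P ⊗ Q) ⅋ R   ≲⟨ normal-axiom switch ⟩
    P ⊗ (Q ⅋ R)   ≲⟨ ⊗-mono ⟶ₙ*-refl ⊢Q⅋R ⟩
    P ⊗ 𝟙         ≈⟨ ⊗-comm ⟩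
    𝟙 ⊗ P         ≈⟨ ⊗-unit ⟩
    P             ∎
    where open ⟶ₙ*-Reasoning

  -- Ideals of structures

  record IsIdeal (X : Pred (Str A) 0ℓ) : Set where
    field
      down-closed : P ⟶ₙ* Q → X Q → X P
      &-closed    : X P → X Q → X (P & Q)

  open IsIdeal

  private variable
    X Y Z X′ Y′ : Pred (Str A) 0ℓ

  data ⟨_⟩ (X : Pred (Str A) 0ℓ) : Pred (Str A) 0ℓ where
    gen     : X P → ⟨ X ⟩ P
    down    : P ⟶ₙ* Q → ⟨ X ⟩ Q → ⟨ X ⟩ P
    &-intro : ⟨ X ⟩ P → ⟨ X ⟩ Q → ⟨ X ⟩ (P & Q)

  ⟨⟩-isIdeal : IsIdeal ⟨ X ⟩
  ⟨⟩-isIdeal = record { down-closed = down ; &-closed = &-intro }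

  ⟨⟩-least : IsIdeal Y → X ⊆ Y → ⟨ X ⟩ ⊆ Y
  ⟨⟩-least Y-ideal X⊆Y (gen x)       = X⊆Y x
  ⟨⟩-least Y-ideal X⊆Y (down le x)   = down-closed Y-ideal le (⟨⟩-least Y-ideal X⊆Y x)
  ⟨⟩-least Y-ideal X⊆Y (&-intro x y) =
    &-closed Y-ideal (⟨⟩-least Y-ideal X⊆Y x) (⟨⟩-least Y-ideal X⊆Y y)

  ⟨⟩-mono : X ⊆ Y → ⟨ X ⟩ ⊆ ⟨ Y ⟩
  ⟨⟩-mono X⊆Y = ⟨⟩-least ⟨⟩-isIdeal (λ x → gen (X⊆Y x))

  Provable-isIdeal : IsIdeal Provable
  Provable-isIdeal = record
    { down-closed = ⟶ₙ*-trans
    ; &-closed    = λ ⊢P ⊢Q → ⟶ₙ*-trans (&-mono ⊢P ⊢Q) (normal-axiom tidy) }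

  ∩-isIdeal : IsIdeal X → IsIdeal Y → IsIdeal (X ∩ Y)
  ∩-isIdeal X-ideal Y-ideal = record
    { down-closed = λ le (x , y) → down-closed X-ideal le x , down-closed Y-ideal le y
    ; &-closed    = λ (x , y) (x′ , y′) → &-closed X-ideal x x′ , &-closed Y-ideal y y′ }

  preimage-isIdeal : (f : Str A → Str A) →
                     (∀ {P Q} → P ⟶ₙ* Q → f P ⟶ₙ* f Q) →
                     (∀ {P Q} → f (P & Q) ⟶ₙ* (f P & f Q)) →
                     IsIdeal X → IsIdeal (f ⊢ X)
  preimage-isIdeal f f-mono f-distrib X-ideal = record
    { down-closed = λ le → down-closed X-ideal (f-mono le)
    ; &-closed    = λ x y → down-closed X-ideal f-distrib (&-closed X-ideal x y) }

  ⅋ʳ-preimage-isIdeal : IsIdeal X → IsIdeal ((_⅋ R) ⊢ X)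
  ⅋ʳ-preimage-isIdeal = preimage-isIdeal _ (λ le → ⅋-mono le ⟶ₙ*-refl) (normal-axiom external)

  ⅋ˡ-preimage-isIdeal : IsIdeal X → IsIdeal ((R ⅋_) ⊢ X)
  ⅋ˡ-preimage-isIdeal = preimage-isIdeal _ (⅋-mono ⟶ₙ*-refl) external′
    where
    external′ : (R ⅋ (P & Q)) ⟶ₙ* ((R ⅋ P) & (R ⅋ Q))
    external′ = ≈-⟶ₙ*-trans ⅋-comm
      (⟶ₙ*-trans (normal-axiom external) (done (&-cong ⅋-comm ⅋-comm)))

  _⊸_ : Pred (Str A) 0ℓ → Pred (Str A) 0ℓ → Pred (Str A) 0ℓ
  (X ⊸ Y) P = ∀ {Q} → X Q → Y (Q ⅋ P)

  ⊸-isIdeal : IsIdeal Y → IsIdeal (X ⊸ Y)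
  ⊸-isIdeal Y-ideal = record
    { down-closed = λ le f x → down-closed (⅋ˡ-preimage-isIdeal Y-ideal) le (f x)
    ; &-closed    = λ f g x → &-closed (⅋ˡ-preimage-isIdeal Y-ideal) (f x) (g x) }

  _⅋ᵈ_ : Pred (Str A) 0ℓ → Pred (Str A) 0ℓ → Pred (Str A) 0ℓ
  (X ⅋ᵈ Y) P = ∃₂ λ Q R → X Q × Y R × P ⟶ₙ* (Q ⅋ R)

  _︔ᵈ_ : Pred (Str A) 0ℓ → Pred (Str A) 0ℓ → Pred (Str A) 0ℓ
  (X ︔ᵈ Y) P = ∃₂ λ Q R → X Q × Y R × P ⟶ₙ* (Q ︔ R)

  ⅋ᵈ-mono : X ⊆ X′ → Y ⊆ Y′ → (X ⅋ᵈ Y) ⊆ (X′ ⅋ᵈ Y′)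
  ⅋ᵈ-mono f g (Q , R , x , y , le) = Q , R , f x , g y , le

  ⅋ᵈ-comm : (X ⅋ᵈ Y) ⊆ (Y ⅋ᵈ X)
  ⅋ᵈ-comm (Q , R , x , y , le) = R , Q , y , x , ⟶ₙ*-trans le (done ⅋-comm)

  ⟨⅋ᵈ⟩-least : IsIdeal Z → (∀ {P Q} → X P → Y Q → Z (P ⅋ Q)) → ⟨ X ⅋ᵈ Y ⟩ ⊆ Z
  ⟨⅋ᵈ⟩-least Z-ideal f = ⟨⟩-least Z-ideal (λ (_ , _ , x , y , le) → down-closed Z-ideal le (f x y))

  ︔ᵈ-mono : X ⊆ X′ → Y ⊆ Y′ → (X ︔ᵈ Y) ⊆ (X′ ︔ᵈ Y′)
  ︔ᵈ-mono f g (Q , R , x , y , le) = Q , R , f x , g y , le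

  ︔ᵈ-isIdeal : IsIdeal X → IsIdeal Y → IsIdeal (X ︔ᵈ Y)
  ︔ᵈ-isIdeal X-ideal Y-ideal = record
    { down-closed = λ le (Q , R , x , y , le′) → Q , R , x , y , ⟶ₙ*-trans le le′
    ; &-closed    = λ (Q , R , x , y , le) (Q′ , R′ , x′ , y′ , le′) →
        (Q & Q′) , (R & R′) , &-closed X-ideal x x′ , &-closed Y-ideal y y′ ,
        ⟶ₙ*-trans (&-mono le le′) (normal-axiom medial) }

  ︔ᵈ-assoc : ((X ︔ᵈ Y) ︔ᵈ Z) ⊆ (X ︔ᵈ (Y ︔ᵈ Z))
  ︔ᵈ-assoc (_ , R , (P , Q , x , y , le) , z , le′) =
    P , (Q ︔ R) , x , (Q , R , y , z , ⟶ₙ*-refl) ,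
    ⟶ₙ*-trans le′ (⟶ₙ*-trans (︔-mono le ⟶ₙ*-refl) (done ︔-assoc))

  ︔ᵈ-assoc⁻¹ : (X ︔ᵈ (Y ︔ᵈ Z)) ⊆ ((X ︔ᵈ Y) ︔ᵈ Z)
  ︔ᵈ-assoc⁻¹ (P , _ , x , (Q , R , y , z , le) , le′) =
    (P ︔ Q) , R , (P , Q , x , y , ⟶ₙ*-refl) , z ,
    ⟶ₙ*-trans le′ (⟶ₙ*-trans (︔-mono ⟶ₙ*-refl le) (done (≈-sym ︔-assoc)))

  ︔ᵈ-identityˡ : IsIdeal X → (Provable ︔ᵈ X) ⊆ X
  ︔ᵈ-identityˡ X-ideal (_ , _ , ⊢P , x , le) =
    down-closed X-ideal (⟶ₙ*-trans le (︔-provableˡ ⊢P)) x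

  ︔ᵈ-identityʳ : IsIdeal X → (X ︔ᵈ Provable) ⊆ X
  ︔ᵈ-identityʳ X-ideal (_ , _ , x , ⊢Q , le) =
    down-closed X-ideal (⟶ₙ*-trans le (︔-provableʳ ⊢Q)) x

  ︔ᵈ-identityˡ⁻¹ : X ⊆ (Provable ︔ᵈ X)
  ︔ᵈ-identityˡ⁻¹ x = 𝟙 , _ , ⟶ₙ*-refl , x , done (≈-sym ︔-unitˡ)

  ︔ᵈ-identityʳ⁻¹ : X ⊆ (X ︔ᵈ Provable)
  ︔ᵈ-identityʳ⁻¹ x = _ , 𝟙 , x , ⟶ₙ*-refl , done (≈-sym ︔-unitʳ)

  -- The Chu model

  -- Keeping the invariants out of Chu makes _⊥ᶜ definitionally involutive, so that ⊗ᶜ and ⊕ᶜ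
  -- are literally the de Morgan duals of ⅋ᶜ and &ᶜ and ⟦ P ⊥ ⟧ ≡ ⟦ P ⟧ ⊥ᶜ holds by computation.
  record Chu : Set₁ where
    field
      pos neg : Pred (Str A) 0ℓ

  open Chu

  record IsChu (p : Chu) : Set where
    field
      pos-ideal  : IsIdeal (pos p)
      neg-ideal  : IsIdeal (neg p)
      orthogonal : ∀ {P Q} → pos p P → neg p Q → Provable (P ⅋ Q)

  open IsChu

  private variable
    p q r p′ q′ : Chu

  _⊥ᶜ : Chu → Chu
  p ⊥ᶜ = record { pos = neg p ; neg = pos p }

  𝟙ᶜ : Chu
  𝟙ᶜ = record { pos = Provable ; neg = Provable }

  atomᶜ : A → Chu
  atomᶜ a = record { pos = ⟨ _≡ atom a ⟩ ; neg = ⟨ _≡ natom a ⟩ }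

  _⅋ᶜ_ : Chu → Chu → Chu
  p ⅋ᶜ q = record { pos = ⟨ pos p ⅋ᵈ pos q ⟩ ; neg = (pos p ⊸ neg q) ∩ (pos q ⊸ neg p) }

  _︔ᶜ_ : Chu → Chu → Chu
  p ︔ᶜ q = record { pos = pos p ︔ᵈ pos q ; neg = neg p ︔ᵈ neg q }

  _&ᶜ_ : Chu → Chu → Chu
  p &ᶜ q = record { pos = ⟨ pos p ∪ pos q ⟩ ; neg = neg p ∩ neg q }

  _⊗ᶜ_ : Chu → Chu → Chu
  p ⊗ᶜ q = ((p ⊥ᶜ) ⅋ᶜ (q ⊥ᶜ)) ⊥ᶜ

  _⊕ᶜ_ : Chu → Chu → Chu
  p ⊕ᶜ q = ((p ⊥ᶜ) &ᶜ (q ⊥ᶜ)) ⊥ᶜ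

  ⊥ᶜ-isChu : IsChu p → IsChu (p ⊥ᶜ)
  ⊥ᶜ-isChu p-chu = record
    { pos-ideal  = neg-ideal p-chu
    ; neg-ideal  = pos-ideal p-chu
    ; orthogonal = λ y x → ≈-⟶ₙ*-trans ⅋-comm (orthogonal p-chu x y) }

  𝟙ᶜ-isChu : IsChu 𝟙ᶜ
  𝟙ᶜ-isChu = record
    { pos-ideal  = Provable-isIdeal
    ; neg-ideal  = Provable-isIdeal
    ; orthogonal = λ ⊢P ⊢Q → ⟶ₙ*-trans (⅋-provableˡ ⊢P) ⊢Q }

  atomᶜ-isChu : (a : A) → IsChu (atomᶜ a)
  atomᶜ-isChu a = record
    { pos-ideal  = ⟨⟩-isIdeal
    ; neg-ideal  = ⟨⟩-isIdeal
    ; orthogonal = λ x y →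
        ⟨⟩-least (⅋ʳ-preimage-isIdeal Provable-isIdeal)
          (λ { refl → ⟨⟩-least (⅋ˡ-preimage-isIdeal Provable-isIdeal)
                        (λ { refl → ≈-⟶ₙ*-trans ⅋-comm (normal-axiom atomInteract) }) y }) x }

  ⅋ᶜ-isChu : IsChu p → IsChu q → IsChu (p ⅋ᶜ q)
  ⅋ᶜ-isChu p-chu q-chu = record
    { pos-ideal  = ⟨⟩-isIdeal
    ; neg-ideal  = ∩-isIdeal (⊸-isIdeal (neg-ideal q-chu)) (⊸-isIdeal (neg-ideal p-chu))
    ; orthogonal = λ {_} {R} u (f , _) →
        ⟨⟩-least (⅋ʳ-preimage-isIdeal Provable-isIdeal)
          (λ (P , Q , x , y , le) →
            ⟶ₙ*-trans (⅋-mono le ⟶ₙ*-refl)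
              (≈-⟶ₙ*-trans (xy∙z≈y∙xz P Q R) (orthogonal q-chu y (f x)))) u }

  ︔ᶜ-isChu : IsChu p → IsChu q → IsChu (p ︔ᶜ q)
  ︔ᶜ-isChu {p} {q} p-chu q-chu = record
    { pos-ideal  = ︔ᵈ-isIdeal (pos-ideal p-chu) (pos-ideal q-chu)
    ; neg-ideal  = ︔ᵈ-isIdeal (neg-ideal p-chu) (neg-ideal q-chu)
    ; orthogonal = orthogonal-︔ }
    where
    orthogonal-︔ : (pos p ︔ᵈ pos q) P → (neg p ︔ᵈ neg q) Q → Provable (P ⅋ Q)
    orthogonal-︔ {P} {Q} (P₁ , P₂ , x₁ , x₂ , P⟶) (Q₁ , Q₂ , y₁ , y₂ , Q⟶) = begin
      P ⅋ Q                   ≲⟨ ⅋-sequence P⟶ Q⟶ ⟩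
      (P₁ ⅋ Q₁) ︔ (P₂ ⅋ Q₂)   ≲⟨ ︔-mono (orthogonal p-chu x₁ y₁) (orthogonal q-chu x₂ y₂) ⟩
      𝟙 ︔ 𝟙                   ≈⟨ ︔-unitˡ ⟩
      𝟙                       ∎
      where open ⟶ₙ*-Reasoning

  &ᶜ-isChu : IsChu p → IsChu q → IsChu (p &ᶜ q)
  &ᶜ-isChu p-chu q-chu = record
    { pos-ideal  = ⟨⟩-isIdeal
    ; neg-ideal  = ∩-isIdeal (neg-ideal p-chu) (neg-ideal q-chu)
    ; orthogonal = λ x (y₁ , y₂) →
        ⟨⟩-least (⅋ʳ-preimage-isIdeal Provable-isIdeal)
          ⊎.[ (λ x₁ → orthogonal p-chu x₁ y₁) , (λ x₂ → orthogonal q-chu x₂ y₂) ] x }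

  ⊗ᶜ-isChu : IsChu p → IsChu q → IsChu (p ⊗ᶜ q)
  ⊗ᶜ-isChu p-chu q-chu = ⊥ᶜ-isChu (⅋ᶜ-isChu (⊥ᶜ-isChu p-chu) (⊥ᶜ-isChu q-chu))

  ⊕ᶜ-isChu : IsChu p → IsChu q → IsChu (p ⊕ᶜ q)
  ⊕ᶜ-isChu p-chu q-chu = ⊥ᶜ-isChu (&ᶜ-isChu (⊥ᶜ-isChu p-chu) (⊥ᶜ-isChu q-chu))

  infix 4 _⊑_ _≅_

  _⊑_ : Chu → Chu → Set
  p ⊑ q = pos p ⊆ pos q × neg q ⊆ neg p

  _≅_ : Chu → Chu → Set
  p ≅ q = p ⊑ q × q ⊑ p

  ⊑-refl : p ⊑ p
  ⊑-refl = (λ x → x) , (λ y → y)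

  ⊑-trans : p ⊑ q → q ⊑ r → p ⊑ r
  ⊑-trans (f , g) (f′ , g′) = (λ x → f′ (f x)) , (λ y → g (g′ y))

  ⊥ᶜ-antitone : p ⊑ q → q ⊥ᶜ ⊑ p ⊥ᶜ
  ⊥ᶜ-antitone (f , g) = g , f

  ≅-refl : p ≅ p
  ≅-refl = ⊑-refl , ⊑-refl

  ≅-sym : p ≅ q → q ≅ p
  ≅-sym (f , g) = g , f

  ≅-trans : p ≅ q → q ≅ r → p ≅ r
  ≅-trans (f , g) (f′ , g′) = ⊑-trans f f′ , ⊑-trans g′ g

  ⊥ᶜ-cong : p ≅ q → p ⊥ᶜ ≅ q ⊥ᶜ
  ⊥ᶜ-cong (f , g) = ⊥ᶜ-antitone g , ⊥ᶜ-antitone f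

  Monotone₂ : (Chu → Chu → Chu) → Set₁
  Monotone₂ _⊙_ = ∀ {p p′ q q′} → p ⊑ p′ → q ⊑ q′ → (p ⊙ q) ⊑ (p′ ⊙ q′)

  ≅-cong₂ : {_⊙_ : Chu → Chu → Chu} → Monotone₂ _⊙_ → p ≅ p′ → q ≅ q′ → (p ⊙ q) ≅ (p′ ⊙ q′)
  ≅-cong₂ mono (f , g) (f′ , g′) = mono f f′ , mono g g′

  ⅋ᶜ-mono : Monotone₂ _⅋ᶜ_
  ⅋ᶜ-mono (f , g) (f′ , g′) =
    ⟨⟩-mono (⅋ᵈ-mono f f′) , (λ (h , k) → (λ x → g′ (h (f x))) , (λ y → g (k (f′ y))))

  ⊗ᶜ-mono : Monotone₂ _⊗ᶜ_
  ⊗ᶜ-mono p⊑p′ q⊑q′ = ⊥ᶜ-antitone (⅋ᶜ-mono (⊥ᶜ-antitone p⊑p′) (⊥ᶜ-antitone q⊑q′))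

  ︔ᶜ-mono : Monotone₂ _︔ᶜ_
  ︔ᶜ-mono (f , g) (f′ , g′) = ︔ᵈ-mono f f′ , ︔ᵈ-mono g g′

  &ᶜ-mono : Monotone₂ _&ᶜ_
  &ᶜ-mono (f , g) (f′ , g′) = ⟨⟩-mono (⊎.map f f′) , (λ (x , y) → g x , g′ y)

  ⊕ᶜ-mono : Monotone₂ _⊕ᶜ_
  ⊕ᶜ-mono p⊑p′ q⊑q′ = ⊥ᶜ-antitone (&ᶜ-mono (⊥ᶜ-antitone p⊑p′) (⊥ᶜ-antitone q⊑q′))

  ⅋ᶜ-comm : (p q : Chu) → p ⅋ᶜ q ≅ q ⅋ᶜ p
  ⅋ᶜ-comm p q = swap p q , swap q p
    where
    swap : (p q : Chu) → p ⅋ᶜ q ⊑ q ⅋ᶜ p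
    swap p q = ⟨⟩-mono ⅋ᵈ-comm , (λ (h , k) → k , h)

  ⅋ᶜ-identityˡ : IsChu p → 𝟙ᶜ ⅋ᶜ p ≅ p
  ⅋ᶜ-identityˡ p-chu =
    ( ⟨⅋ᵈ⟩-least (pos-ideal p-chu) (λ ⊢P x → down-closed (pos-ideal p-chu) (⅋-provableˡ ⊢P) x)
    , (λ y → (λ ⊢P → down-closed (neg-ideal p-chu) (⅋-provableˡ ⊢P) y) , (λ x → orthogonal p-chu x y)) )
    ,
    ( (λ x → gen (𝟙 , _ , ⟶ₙ*-refl , x , done (≈-sym ⅋-unit)))
    , (λ (h , _) → down-closed (neg-ideal p-chu) (done (≈-sym ⅋-unit)) (h ⟶ₙ*-refl)) )

  ⅋ᶜ-assoc : IsChu p → IsChu q → IsChu r → (p ⅋ᶜ q) ⅋ᶜ r ≅ p ⅋ᶜ (q ⅋ᶜ r)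
  ⅋ᶜ-assoc {p} {q} {r} p-chu q-chu r-chu =
    reassociate p-chu q-chu r-chu ,
    ⊑-trans (proj₁ (⅋ᶜ-comm p (q ⅋ᶜ r)))
      (⊑-trans (reassociate q-chu r-chu p-chu)
        (⊑-trans (proj₁ (⅋ᶜ-comm q (r ⅋ᶜ p)))
          (⊑-trans (reassociate r-chu p-chu q-chu) (proj₁ (⅋ᶜ-comm r (p ⅋ᶜ q))))))
    where
    reassociate : ∀ {p q r} → IsChu p → IsChu q → IsChu r → (p ⅋ᶜ q) ⅋ᶜ r ⊑ p ⅋ᶜ (q ⅋ᶜ r)
    reassociate {p} {q} {r} p-chu q-chu r-chu =
      ⟨⅋ᵈ⟩-least ⟨⟩-isIdeal
        (λ {U} {R} u z → ⟨⟩-least (⅋ʳ-preimage-isIdeal ⟨⟩-isIdeal)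
          (λ (P , Q , x , y , le) →
            gen (P , Q ⅋ R , x , gen (Q , R , y , z , ⟶ₙ*-refl) ,
                 ⟶ₙ*-trans (⅋-mono le ⟶ₙ*-refl) (done ⅋-assoc))) u) ,
      (λ {Y} (h , k) →
        (λ u → ⟨⟩-least (⅋ʳ-preimage-isIdeal (neg-ideal r-chu))
          (λ (P , Q , x , y , le) →
            down-closed (neg-ideal r-chu)
              (⟶ₙ*-trans (⅋-mono le ⟶ₙ*-refl) (done (xy∙z≈y∙xz P Q Y)))
              (proj₁ (h x) y)) u) ,
        (λ {R} z →
          (λ {P} x → down-closed (neg-ideal q-chu) (done (x∙yz≈y∙xz P R Y)) (proj₂ (h x) z)) ,
          (λ y → down-closed (neg-ideal p-chu) (done (≈-sym ⅋-assoc))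
                   (k (gen (_ , R , y , z , ⟶ₙ*-refl))))))

  ︔ᶜ-assoc : (p q r : Chu) → (p ︔ᶜ q) ︔ᶜ r ≅ p ︔ᶜ (q ︔ᶜ r)
  ︔ᶜ-assoc p q r = (︔ᵈ-assoc , ︔ᵈ-assoc⁻¹) , (︔ᵈ-assoc⁻¹ , ︔ᵈ-assoc)

  ︔ᶜ-identityˡ : IsChu p → 𝟙ᶜ ︔ᶜ p ≅ p
  ︔ᶜ-identityˡ p-chu =
    (︔ᵈ-identityˡ (pos-ideal p-chu) , ︔ᵈ-identityˡ⁻¹) ,
    (︔ᵈ-identityˡ⁻¹ , ︔ᵈ-identityˡ (neg-ideal p-chu))

  ︔ᶜ-identityʳ : IsChu p → p ︔ᶜ 𝟙ᶜ ≅ p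
  ︔ᶜ-identityʳ p-chu =
    (︔ᵈ-identityʳ (pos-ideal p-chu) , ︔ᵈ-identityʳ⁻¹) ,
    (︔ᵈ-identityʳ⁻¹ , ︔ᵈ-identityʳ (neg-ideal p-chu))

  interactᶜ : IsChu p → p ⅋ᶜ (p ⊥ᶜ) ⊑ 𝟙ᶜ
  interactᶜ p-chu =
    ⟨⅋ᵈ⟩-least Provable-isIdeal (orthogonal p-chu) ,
    (λ ⊢Q → (λ x → down-closed (pos-ideal p-chu) (⅋-provableʳ ⊢Q) x) ,
            (λ y → down-closed (neg-ideal p-chu) (⅋-provableʳ ⊢Q) y))

  switchᶜ : IsChu p → IsChu r → (p ⊗ᶜ q) ⅋ᶜ r ⊑ p ⊗ᶜ (q ⅋ᶜ r)
  switchᶜ p-chu r-chu =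
    ⟨⅋ᵈ⟩-least (∩-isIdeal (⊸-isIdeal ⟨⟩-isIdeal) (⊸-isIdeal (pos-ideal p-chu)))
      (λ {U} {R} (h₁ , h₂) z →
        (λ {X} x → gen (X ⅋ U , R , h₁ x , z , done (≈-sym ⅋-assoc))) ,
        (λ {W} (_ , k₂) → down-closed (pos-ideal p-chu) (done (x∙yz≈zx∙y W U R)) (h₂ (k₂ z)))) ,
    ⟨⅋ᵈ⟩-least (∩-isIdeal (⊸-isIdeal (neg-ideal r-chu)) (⊸-isIdeal ⟨⟩-isIdeal))
      (λ {X} {W} x (k₁ , k₂) →
        (λ {U} (h₁ , _) → down-closed (neg-ideal r-chu) (done (x∙yz≈yx∙z U X W)) (k₁ (h₁ x))) ,
        (λ {R} z → gen (X , R ⅋ W , x , k₂ z , done (x∙yz≈y∙xz R X W))))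

  tidyᶜ : 𝟙ᶜ &ᶜ 𝟙ᶜ ⊑ 𝟙ᶜ
  tidyᶜ = ⟨⟩-least Provable-isIdeal ⊎.reduce , (λ ⊢P → ⊢P , ⊢P)

  sequenceᶜ : (p q r s : Chu) → (p ︔ᶜ q) ⅋ᶜ (r ︔ᶜ s) ⊑ (p ⅋ᶜ r) ︔ᶜ (q ⅋ᶜ s)
  sequenceᶜ p q r s =
    ⟨⅋ᵈ⟩-least (︔ᵈ-isIdeal ⟨⟩-isIdeal ⟨⟩-isIdeal)
      (λ (P , Q , x , y , le) (R , S , z , w , le′) →
        (P ⅋ R) , (Q ⅋ S) , gen (P , R , x , z , ⟶ₙ*-refl) , gen (Q , S , y , w , ⟶ₙ*-refl) ,
        ⅋-sequence le le′) ,
    (λ (_ , _ , (h₁ , h₂) , (k₁ , k₂) , le) →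
      (λ (_ , _ , x , y , le′) → _ , _ , h₁ x , k₁ y , ⅋-sequence le′ le) ,
      (λ (_ , _ , z , w , le′) → _ , _ , h₂ z , k₂ w , ⅋-sequence le′ le))

  leftᶜ : (p q : Chu) → p ⊕ᶜ q ⊑ p
  leftᶜ p q = proj₁ , (λ y → gen (inj₁ y))

  rightᶜ : (p q : Chu) → p ⊕ᶜ q ⊑ q
  rightᶜ p q = proj₂ , (λ y → gen (inj₂ y))

  externalᶜ : IsChu r → (p &ᶜ q) ⅋ᶜ r ⊑ (p ⅋ᶜ r) &ᶜ (q ⅋ᶜ r)
  externalᶜ r-chu =
    ⟨⅋ᵈ⟩-least ⟨⟩-isIdeal
      (λ u z → ⟨⟩-least (⅋ʳ-preimage-isIdeal ⟨⟩-isIdeal)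
        ⊎.[ (λ x → gen (inj₁ (gen (_ , _ , x , z , ⟶ₙ*-refl))))
          , (λ y → gen (inj₂ (gen (_ , _ , y , z , ⟶ₙ*-refl)))) ] u) ,
    (λ ((h₁ , h₂) , (k₁ , k₂)) →
      (λ u → ⟨⟩-least (⅋ʳ-preimage-isIdeal (neg-ideal r-chu)) ⊎.[ h₁ , k₁ ] u) ,
      (λ z → h₂ z , k₂ z))

  medialᶜ : (p q r s : Chu) → (p ︔ᶜ q) &ᶜ (r ︔ᶜ s) ⊑ (p &ᶜ r) ︔ᶜ (q &ᶜ s)
  medialᶜ p q r s =
    ⟨⟩-least (︔ᵈ-isIdeal ⟨⟩-isIdeal ⟨⟩-isIdeal)
      ⊎.[ ︔ᵈ-mono (λ x → gen (inj₁ x)) (λ y → gen (inj₁ y))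
        , ︔ᵈ-mono (λ x → gen (inj₂ x)) (λ y → gen (inj₂ y)) ] ,
    (λ d → ︔ᵈ-mono proj₁ proj₁ d , ︔ᵈ-mono proj₂ proj₂ d)

  -- Interpretation and soundness

  ⟦_⟧ : Str A → Chu
  ⟦ atom a ⟧  = atomᶜ a
  ⟦ natom a ⟧ = atomᶜ a ⊥ᶜ
  ⟦ 𝟙 ⟧       = 𝟙ᶜ
  ⟦ P ︔ Q ⟧   = ⟦ P ⟧ ︔ᶜ ⟦ Q ⟧
  ⟦ P ⊗ Q ⟧   = ⟦ P ⟧ ⊗ᶜ ⟦ Q ⟧
  ⟦ P ⅋ Q ⟧   = ⟦ P ⟧ ⅋ᶜ ⟦ Q ⟧
  ⟦ P & Q ⟧   = ⟦ P ⟧ &ᶜ ⟦ Q ⟧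
  ⟦ P ⊕ Q ⟧   = ⟦ P ⟧ ⊕ᶜ ⟦ Q ⟧

  ⟦⟧-isChu : (P : Str A) → IsChu ⟦ P ⟧
  ⟦⟧-isChu (atom a)  = atomᶜ-isChu a
  ⟦⟧-isChu (natom a) = ⊥ᶜ-isChu (atomᶜ-isChu a)
  ⟦⟧-isChu 𝟙         = 𝟙ᶜ-isChu
  ⟦⟧-isChu (P ︔ Q)   = ︔ᶜ-isChu (⟦⟧-isChu P) (⟦⟧-isChu Q)
  ⟦⟧-isChu (P ⊗ Q)   = ⊗ᶜ-isChu (⟦⟧-isChu P) (⟦⟧-isChu Q)
  ⟦⟧-isChu (P ⅋ Q)   = ⅋ᶜ-isChu (⟦⟧-isChu P) (⟦⟧-isChu Q)
  ⟦⟧-isChu (P & Q)   = &ᶜ-isChu (⟦⟧-isChu P) (⟦⟧-isChu Q)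
  ⟦⟧-isChu (P ⊕ Q)   = ⊕ᶜ-isChu (⟦⟧-isChu P) (⟦⟧-isChu Q)

  ⟦⊥⟧ : (P : Str A) → ⟦ P ⊥ ⟧ ≡ ⟦ P ⟧ ⊥ᶜ
  ⟦⊥⟧ (atom a)  = refl
  ⟦⊥⟧ (natom a) = refl
  ⟦⊥⟧ 𝟙         = refl
  ⟦⊥⟧ (P ︔ Q)   = cong₂ _︔ᶜ_ (⟦⊥⟧ P) (⟦⊥⟧ Q)
  ⟦⊥⟧ (P ⊗ Q)   = cong₂ _⅋ᶜ_ (⟦⊥⟧ P) (⟦⊥⟧ Q)
  ⟦⊥⟧ (P ⅋ Q)   = cong₂ _⊗ᶜ_ (⟦⊥⟧ P) (⟦⊥⟧ Q)
  ⟦⊥⟧ (P & Q)   = cong₂ _⊕ᶜ_ (⟦⊥⟧ P) (⟦⊥⟧ Q)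
  ⟦⊥⟧ (P ⊕ Q)   = cong₂ _&ᶜ_ (⟦⊥⟧ P) (⟦⊥⟧ Q)

  ⟦⟧-resp-≈ : P ≈ Q → ⟦ P ⟧ ≅ ⟦ Q ⟧
  ⟦⟧-resp-≈ ≈-refl          = ≅-refl
  ⟦⟧-resp-≈ (≈-sym e)       = ≅-sym (⟦⟧-resp-≈ e)
  ⟦⟧-resp-≈ (≈-trans e e′)  = ≅-trans (⟦⟧-resp-≈ e) (⟦⟧-resp-≈ e′)
  ⟦⟧-resp-≈ (︔-cong e e′)   = ≅-cong₂ ︔ᶜ-mono (⟦⟧-resp-≈ e) (⟦⟧-resp-≈ e′)
  ⟦⟧-resp-≈ (⊗-cong e e′)   = ≅-cong₂ ⊗ᶜ-mono (⟦⟧-resp-≈ e) (⟦⟧-resp-≈ e′)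
  ⟦⟧-resp-≈ (⅋-cong e e′)   = ≅-cong₂ ⅋ᶜ-mono (⟦⟧-resp-≈ e) (⟦⟧-resp-≈ e′)
  ⟦⟧-resp-≈ (&-cong e e′)   = ≅-cong₂ &ᶜ-mono (⟦⟧-resp-≈ e) (⟦⟧-resp-≈ e′)
  ⟦⟧-resp-≈ (⊕-cong e e′)   = ≅-cong₂ ⊕ᶜ-mono (⟦⟧-resp-≈ e) (⟦⟧-resp-≈ e′)
  ⟦⟧-resp-≈ (︔-assoc {P} {Q} {R}) = ︔ᶜ-assoc ⟦ P ⟧ ⟦ Q ⟧ ⟦ R ⟧
  ⟦⟧-resp-≈ (︔-unitˡ {P})   = ︔ᶜ-identityˡ (⟦⟧-isChu P)
  ⟦⟧-resp-≈ (︔-unitʳ {P})   = ︔ᶜ-identityʳ (⟦⟧-isChu P)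
  ⟦⟧-resp-≈ (⊗-assoc {P} {Q} {R}) =
    ⊥ᶜ-cong (⅋ᶜ-assoc (⊥ᶜ-isChu (⟦⟧-isChu P)) (⊥ᶜ-isChu (⟦⟧-isChu Q)) (⊥ᶜ-isChu (⟦⟧-isChu R)))
  ⟦⟧-resp-≈ (⊗-comm {P} {Q}) = ⊥ᶜ-cong (⅋ᶜ-comm (⟦ P ⟧ ⊥ᶜ) (⟦ Q ⟧ ⊥ᶜ))
  ⟦⟧-resp-≈ (⊗-unit {P})    = ⊥ᶜ-cong (⅋ᶜ-identityˡ (⊥ᶜ-isChu (⟦⟧-isChu P)))
  ⟦⟧-resp-≈ (⅋-assoc {P} {Q} {R}) = ⅋ᶜ-assoc (⟦⟧-isChu P) (⟦⟧-isChu Q) (⟦⟧-isChu R)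
  ⟦⟧-resp-≈ (⅋-comm {P} {Q}) = ⅋ᶜ-comm ⟦ P ⟧ ⟦ Q ⟧
  ⟦⟧-resp-≈ (⅋-unit {P})    = ⅋ᶜ-identityˡ (⟦⟧-isChu P)

  ⟦⟧-axiom : MAVAx P Q → ⟦ P ⟧ ⊑ ⟦ Q ⟧
  ⟦⟧-axiom (interact {P}) rewrite ⟦⊥⟧ P = interactᶜ (⟦⟧-isChu P)
  ⟦⟧-axiom (switch {P} {_} {R}) = switchᶜ (⟦⟧-isChu P) (⟦⟧-isChu R)
  ⟦⟧-axiom tidy = tidyᶜ
  ⟦⟧-axiom (sequence {P} {Q} {R} {S}) = sequenceᶜ ⟦ P ⟧ ⟦ Q ⟧ ⟦ R ⟧ ⟦ S ⟧
  ⟦⟧-axiom (left {P} {Q}) = leftᶜ ⟦ P ⟧ ⟦ Q ⟧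
  ⟦⟧-axiom (right {P} {Q}) = rightᶜ ⟦ P ⟧ ⟦ Q ⟧
  ⟦⟧-axiom (external {P} {Q} {R}) = externalᶜ {p = ⟦ P ⟧} {q = ⟦ Q ⟧} (⟦⟧-isChu R)
  ⟦⟧-axiom (medial {P} {Q} {R} {S}) = medialᶜ ⟦ P ⟧ ⟦ Q ⟧ ⟦ R ⟧ ⟦ S ⟧
  -- Each co-rule is sound as the ⊥ᶜ-dual of its rule.
  ⟦⟧-axiom (cointeract {P}) rewrite ⟦⊥⟧ P = ⊥ᶜ-antitone (interactᶜ (⊥ᶜ-isChu (⟦⟧-isChu P)))
  ⟦⟧-axiom cotidy = ⊥ᶜ-antitone tidyᶜ
  ⟦⟧-axiom (cosequence {P} {Q} {R} {S}) =
    ⊥ᶜ-antitone (sequenceᶜ (⟦ P ⟧ ⊥ᶜ) (⟦ Q ⟧ ⊥ᶜ) (⟦ R ⟧ ⊥ᶜ) (⟦ S ⟧ ⊥ᶜ))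
  ⟦⟧-axiom (coleft {P} {Q}) = ⊥ᶜ-antitone (leftᶜ (⟦ P ⟧ ⊥ᶜ) (⟦ Q ⟧ ⊥ᶜ))
  ⟦⟧-axiom (coright {P} {Q}) = ⊥ᶜ-antitone (rightᶜ (⟦ P ⟧ ⊥ᶜ) (⟦ Q ⟧ ⊥ᶜ))
  ⟦⟧-axiom (coexternal {P} {Q} {R}) =
    ⊥ᶜ-antitone (externalᶜ {p = ⟦ P ⟧ ⊥ᶜ} {q = ⟦ Q ⟧ ⊥ᶜ} (⊥ᶜ-isChu (⟦⟧-isChu R)))
  ⟦⟧-axiom (comedial {P} {Q} {R} {S}) =
    ⊥ᶜ-antitone (medialᶜ (⟦ P ⟧ ⊥ᶜ) (⟦ Q ⟧ ⊥ᶜ) (⟦ R ⟧ ⊥ᶜ) (⟦ S ⟧ ⊥ᶜ))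

  ⟦⟧-[] : (C : Ctx) → ⟦ P ⟧ ⊑ ⟦ Q ⟧ → ⟦ C [ P ] ⟧ ⊑ ⟦ C [ Q ] ⟧
  ⟦⟧-[] ∙        le = le
  ⟦⟧-[] (C ︔ˡ R) le = ︔ᶜ-mono (⟦⟧-[] C le) (⊑-refl {p = ⟦ R ⟧})
  ⟦⟧-[] (R ︔ʳ C) le = ︔ᶜ-mono (⊑-refl {p = ⟦ R ⟧}) (⟦⟧-[] C le)
  ⟦⟧-[] (C ⊗ˡ R) le = ⊗ᶜ-mono (⟦⟧-[] C le) (⊑-refl {p = ⟦ R ⟧})
  ⟦⟧-[] (R ⊗ʳ C) le = ⊗ᶜ-mono (⊑-refl {p = ⟦ R ⟧}) (⟦⟧-[] C le)
  ⟦⟧-[] (C ⅋ˡ R) le = ⅋ᶜ-mono (⟦⟧-[] C le) (⊑-refl {p = ⟦ R ⟧})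
  ⟦⟧-[] (R ⅋ʳ C) le = ⅋ᶜ-mono (⊑-refl {p = ⟦ R ⟧}) (⟦⟧-[] C le)
  ⟦⟧-[] (C &ˡ R) le = &ᶜ-mono (⟦⟧-[] C le) (⊑-refl {p = ⟦ R ⟧})
  ⟦⟧-[] (R &ʳ C) le = &ᶜ-mono (⊑-refl {p = ⟦ R ⟧}) (⟦⟧-[] C le)
  ⟦⟧-[] (C ⊕ˡ R) le = ⊕ᶜ-mono (⟦⟧-[] C le) (⊑-refl {p = ⟦ R ⟧})
  ⟦⟧-[] (R ⊕ʳ C) le = ⊕ᶜ-mono (⊑-refl {p = ⟦ R ⟧}) (⟦⟧-[] C le)

  ⟦⟧-sound : P ⟶* Q → ⟦ P ⟧ ⊑ ⟦ Q ⟧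
  ⟦⟧-sound (done P≈Q) = proj₁ (⟦⟧-resp-≈ P≈Q)
  ⟦⟧-sound (step C _ _ P≈Cl ax Cr≈Q ∷ d) =
    ⊑-trans (proj₁ (⟦⟧-resp-≈ P≈Cl))
      (⊑-trans (⟦⟧-[] C (⟦⟧-axiom ax))
        (⊑-trans (proj₁ (⟦⟧-resp-≈ Cr≈Q)) (⟦⟧-sound d)))

  okada : (P : Str A) → pos ⟦ P ⟧ P
  okada (atom a)  = gen refl
  okada (natom a) = gen refl
  okada 𝟙         = ⟶ₙ*-refl
  okada (P ︔ Q)   = P , Q , okada P , okada Q , ⟶ₙ*-refl
  okada (P ⊗ Q)   =
    (λ y → down-closed (pos-ideal (⟦⟧-isChu Q))
             (≈-⟶ₙ*-trans (≈-trans ⅋-comm (⅋-cong ⊗-comm ≈-refl))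
               (⊗-discharge (orthogonal (⟦⟧-isChu P) (okada P) y)))
             (okada Q)) ,
    (λ y → down-closed (pos-ideal (⟦⟧-isChu P))
             (≈-⟶ₙ*-trans ⅋-comm (⊗-discharge (orthogonal (⟦⟧-isChu Q) (okada Q) y)))
             (okada P))
  okada (P ⅋ Q)   = gen (P , Q , okada P , okada Q , ⟶ₙ*-refl)
  okada (P & Q)   = &-intro (gen (inj₁ (okada P))) (gen (inj₂ (okada Q)))
  okada (P ⊕ Q)   =
    down-closed (pos-ideal (⟦⟧-isChu P)) (normal-axiom left) (okada P) ,
    down-closed (pos-ideal (⟦⟧-isChu Q)) (normal-axiom right) (okada Q)

theorem4p2 : {A : Set} (P : Str A) → P ⟶* 𝟙 → P ⟶ₙ* 𝟙
theorem4p2 P P⟶*𝟙 = proj₁ (⟦⟧-sound P⟶*𝟙) (okada P)
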